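{- Let $G$ be a graph and $a,b,c\in V(G)$ distinct. Let $\mathcal{P}_{a,b}$ be a family of $\aleph_0$ pairwise edge-disjoint, pairwise order-compatible $a{ - }b$ paths, and $\mathcal{P}_{b,c}$ a family of $\aleph_0$ pairwise edge-disjoint, pairwise order-compatible $b{ - }c$ paths. Suppose $\mathcal{P}\subseteq\mathcal{P}_{a,b}$ and $\mathcal{Q}\subseteq\mathcal{P}_{b,c}$ are infinite subfamilies admitting a $(\mathcal{P},\mathcal{Q})$-terminal $v$. If $v$ lies on infinitely many paths of $\mathcal{P}$, then there is a family of $\aleph_0$ pairwise edge-disjoint, pairwise order-compatible $a{ - }c$ paths in $G$.
   Context: Graphs may have parallel edges but no loops. Two $x{ - }y$ paths are order-compatible if their common vertices occur in the same order when travelling along each from $x$ to $y$. For $\mathcal{P}\subseteq\mathcal{P}_{a,b}$ and $\mathcal{Q}\subseteq\mathcal{P}_{b,c}$, a vertex $v$ is a $(\mathcal{P},\mathcal{Q})$-terminal if $v$ lies on some path of $\mathcal{P}$, $v$ lies on every path $Q\in\mathcal{Q}$, and for every $Q\in\mathcal{Q}$ the subpath $vQc$ of $Q$ from $v$ to $c$ meets $\bigcup\mathcal{P}$ only in $v$. -}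

module Defs where

open import Data.Nat using (ℕ; zero; suc; _≤_)
open import Data.Fin using (Fin; zero; suc; inject₁; fromℕ)
import Data.Fin as F
open import Data.Product using (Σ; ∃; ∃-syntax; _×_; _,_; proj₁; proj₂)
open import Data.Sum using (_⊎_)
open import Relation.Binary.PropositionalEquality using (_≡_; _≢_)
open import Relation.Nullary using (¬_)
open import Function.Definitions using (Injective)

-- A (possibly infinite) multigraph without loops: edges are elements of E
-- (so parallel edges are distinct elements), each with two distinct ends.
record Graph : Set₁ where
  field
    V    : Set
    E    : Set
    ends : E → V × V
    noLoop : ∀ e → proj₁ (ends e) ≢ proj₂ (ends e)

module _ (G : Graph) where
  open Graph G

  Joins : E → V → V → Set
  Joins e u w = ends e ≡ (u , w) ⊎ ends e ≡ (w , u)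

  record Path (x y : V) : Set where
    field
      len    : ℕ
      vert   : Fin (suc len) → V
      edge   : Fin len → E
      start  : vert zero ≡ x
      finish : vert (fromℕ len) ≡ y
      distinct : Injective _≡_ _≡_ vert
      links  : ∀ i → Joins (edge i) (vert (inject₁ i)) (vert (suc i))

  open Path public

  OnPath : ∀ {x y} → V → Path x y → Set
  OnPath v P = ∃[ i ] vert P i ≡ v

  EdgeDisjoint : ∀ {x y} → Path x y → Path x y → Set
  EdgeDisjoint P Q = ∀ i j → edge P i ≢ edge Q j

  OrderCompatible : ∀ {x y} → Path x y → Path x y → Set
  OrderCompatible P Q =
    ∀ i j k l → vert P i ≡ vert Q k → vert P j ≡ vert Q l →
      i F.< j → k F.< l

  -- a family of ℵ₀ pairwise edge-disjoint, pairwise order-compatible x–y paths,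
  -- indexed by ℕ (edge-disjointness of distinct indices makes the paths distinct)
  record GoodFamily (x y : V) : Set where
    field
      path : ℕ → Path x y
      edgeDisj : ∀ i j → i ≢ j → EdgeDisjoint (path i) (path j)
      orderComp : ∀ i j → OrderCompatible (path i) (path j)

  open GoodFamily public

Infinite : (ℕ → Set) → Set
Infinite S = ∀ n → ∃[ m ] (n ≤ m × S m)

module _ (G : Graph) where
  open Graph G

  -- v is a (𝒫,𝒬)-terminal, where 𝒫 = {𝒫ab i | S i} and 𝒬 = {𝒫bc j | T j}
  IsTerminal : ∀ {a b c} → GoodFamily G a b → (ℕ → Set) →
               GoodFamily G b c → (ℕ → Set) → V → Set
  IsTerminal 𝒫ab S 𝒫bc T v =
    (∃[ i ] (S i × OnPath G v (path 𝒫ab i)))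
    × (∀ j → T j → OnPath G v (path 𝒫bc j))
    × (∀ j → T j → ∀ k₀ k → vert (path 𝒫bc j) k₀ ≡ v → k₀ F.≤ k →
         (∃[ i ] (S i × OnPath G (vert (path 𝒫bc j) k) (path 𝒫ab i))) →
         vert (path 𝒫bc j) k ≡ v)

{-# OPTIONS --safe #-}
-- Choose infinitely many distinct paths Pₙ ∈ 𝒫 through v and distinct Qₙ ∈ 𝒬,
-- and let Rₙ follow Pₙ from a to v and then Qₙ from v to c.  Since v is a
-- terminal, every tail vQₙc meets ⋃𝒫 only in v.  Hence Rₙ is a path; an edge
-- shared by a path of 𝒫 and a tail vQₘc would have both ends equal to v, which
-- is impossible without loops; and a common vertex of Rₙ and Rₘ other than v
-- lies on both initial segments or on both tails, so edge-disjointness and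
-- order-compatibility are inherited from 𝒫_{a,b} and 𝒫_{b,c}.
module Submission where

open import Defs
open import Data.Nat using (ℕ; zero; suc; _+_; _∸_; _≤_; _<_; _≤?_; z≤n; s≤s)
open import Data.Nat.Properties
open import Data.Fin as F using (Fin; zero; suc; toℕ; fromℕ; fromℕ<; inject₁)
open import Data.Fin.Properties
  using (toℕ-injective; toℕ-fromℕ; toℕ-fromℕ<; toℕ-inject₁; toℕ≤pred[n]; toℕ<n)
open import Data.Product using (_×_; _,_; proj₁; proj₂)
open import Data.Sum using (_⊎_; inj₁; inj₂)
open import Function using (_∘_)
open import Function.Definitions using (Injective)
open import Relation.Binary using (tri<; tri≈; tri>)
open import Relation.Nullary using (¬_; yes; no; contradiction)
open import Relation.Binary.PropositionalEquality
  using (_≡_; _≢_; refl; sym; trans; cong; subst; subst₂; module ≡-Reasoning)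

m∸o<n∸o⇒m<n : ∀ {m n o} → o ≤ m → o ≤ n → m ∸ o < n ∸ o → m < n
m∸o<n∸o⇒m<n {o = o} o≤m o≤n lt =
  subst₂ _<_ (m∸n+n≡m o≤m) (m∸n+n≡m o≤n) (+-monoˡ-< o lt)

module Enumeration {S : ℕ → Set} (infinite : Infinite S) where

  select : ℕ → ℕ
  select zero    = proj₁ (infinite 0)
  select (suc n) = proj₁ (infinite (suc (select n)))

  select-∈ : ∀ n → S (select n)
  select-∈ zero    = proj₂ (proj₂ (infinite 0))
  select-∈ (suc n) = proj₂ (proj₂ (infinite (suc (select n))))

  select-<-suc : ∀ n → select n < select (suc n)
  select-<-suc n = proj₁ (proj₂ (infinite (suc (select n))))

  select-strictMono : ∀ {m n} → m < n → select m < select n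
  select-strictMono {m} {suc n} (s≤s m≤n) with m≤n⇒m<n∨m≡n m≤n
  ... | inj₁ m<n  = <-trans (select-strictMono m<n) (select-<-suc n)
  ... | inj₂ refl = select-<-suc n

  select-injective : Injective _≡_ _≡_ select
  select-injective {m} {n} eq with <-cmp m n
  ... | tri< m<n _ _ = contradiction eq (<⇒≢ (select-strictMono m<n))
  ... | tri≈ _ m≡n _ = m≡n
  ... | tri> _ _ m>n = contradiction eq (>⇒≢ (select-strictMono m>n))

clamp : ∀ n → ℕ → Fin (suc n)
clamp n       zero    = zero
clamp zero    (suc k) = zero
clamp (suc n) (suc k) = suc (clamp n k)

toℕ-clamp : ∀ {n k} → k ≤ n → toℕ (clamp n k) ≡ k
toℕ-clamp {n}     {zero}  _         = refl
toℕ-clamp {suc n} {suc k} (s≤s k≤n) = cong suc (toℕ-clamp k≤n)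

clamp-toℕ : ∀ {n} (f : Fin (suc n)) → clamp n (toℕ f) ≡ f
clamp-toℕ f = toℕ-injective (toℕ-clamp (toℕ≤pred[n] f))

module _ {G : Graph} where
  open Graph G

  Joins-sym : ∀ {e u w} → Joins G e u w → Joins G e w u
  Joins-sym (inj₁ eq) = inj₂ eq
  Joins-sym (inj₂ eq) = inj₁ eq

  Joins-irrefl : ∀ {e u} → ¬ Joins G e u u
  Joins-irrefl {e} (inj₁ eq) = noLoop e (trans (cong proj₁ eq) (sym (cong proj₂ eq)))
  Joins-irrefl {e} (inj₂ eq) = noLoop e (trans (cong proj₁ eq) (sym (cong proj₂ eq)))

  Joins-end : ∀ {e u w u′ w′} → Joins G e u w → Joins G e u′ w′ → u′ ≡ u ⊎ u′ ≡ w
  Joins-end (inj₁ eq) (inj₁ eq′) = inj₁ (cong proj₁ (trans (sym eq′) eq))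
  Joins-end (inj₁ eq) (inj₂ eq′) = inj₂ (cong proj₂ (trans (sym eq′) eq))
  Joins-end (inj₂ eq) (inj₁ eq′) = inj₂ (cong proj₁ (trans (sym eq′) eq))
  Joins-end (inj₂ eq) (inj₂ eq′) = inj₁ (cong proj₂ (trans (sym eq′) eq))

  shared-edge-ends : ∀ {x y x′ y′} (P : Path G x y) (Q : Path G x′ y′) f g →
    edge P f ≡ edge Q g →
    OnPath G (vert Q (inject₁ g)) P × OnPath G (vert Q (suc g)) P
  shared-edge-ends P Q f g eq =
    on-P (Joins-end (links P f) joins) , on-P (Joins-end (links P f) (Joins-sym joins))
    where
    joins : Joins G (edge P f) (vert Q (inject₁ g)) (vert Q (suc g))
    joins = subst (λ e → Joins G e _ _) (sym eq) (links Q g)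
    on-P : ∀ {u} → u ≡ vert P (inject₁ f) ⊎ u ≡ vert P (suc f) → OnPath G u P
    on-P (inj₁ u≡) = _ , sym u≡
    on-P (inj₂ u≡) = _ , sym u≡

  -- Vertices indexed by ℕ, so that positions can be shifted by arithmetic;
  -- indices beyond len P give junk values.
  vertAt : ∀ {x y} → Path G x y → ℕ → V
  vertAt P k = vert P (clamp (len P) k)

  vertAt-toℕ : ∀ {x y} (P : Path G x y) f → vertAt P (toℕ f) ≡ vert P f
  vertAt-toℕ P f = cong (vert P) (clamp-toℕ f)

  vertAt-injective : ∀ {x y} (P : Path G x y) {k l} → k ≤ len P → l ≤ len P →
    vertAt P k ≡ vertAt P l → k ≡ l
  vertAt-injective P k≤ l≤ eq =
    trans (sym (toℕ-clamp k≤)) (trans (cong toℕ (distinct P eq)) (toℕ-clamp l≤))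

  vertAt-orderCompatible : ∀ {x y} (P P′ : Path G x y) → OrderCompatible G P P′ →
    ∀ {i j k l} → i ≤ len P → j ≤ len P → k ≤ len P′ → l ≤ len P′ →
    vertAt P i ≡ vertAt P′ k → vertAt P j ≡ vertAt P′ l → i < j → k < l
  vertAt-orderCompatible _ _ oc i≤ j≤ k≤ l≤ eik ejl i<j =
    subst₂ _<_ (toℕ-clamp k≤) (toℕ-clamp l≤)
      (oc _ _ _ _ eik ejl (subst₂ _<_ (sym (toℕ-clamp i≤)) (sym (toℕ-clamp j≤)) i<j))

module Splicing {G : Graph} {x y z : Graph.V G} (v : Graph.V G) where
  open Graph G

  TailAvoids : Path G x y → (Q : Path G y z) → Fin (suc (len Q)) → Set
  TailAvoids P Q j = ∀ l → j F.≤ l → OnPath G (vert Q l) P → vert Q l ≡ v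

  tail-edge-≢ : ∀ P Q {j} → TailAvoids P Q j →
    (g : Fin (len Q)) → toℕ j ≤ toℕ g → ∀ f → edge P f ≢ edge Q g
  tail-edge-≢ P Q {j} avoids g j≤g f eq =
    Joins-irrefl {G} (subst₂ (Joins G (edge Q g))
      (avoids _ (subst (toℕ j ≤_) (sym (toℕ-inject₁ g)) j≤g) start-on-P)
      (avoids _ (m≤n⇒m≤1+n j≤g) end-on-P)
      (links Q g))
    where
    start-on-P = proj₁ (shared-edge-ends P Q f g eq)
    end-on-P   = proj₂ (shared-edge-ends P Q f g eq)

  -- The path that follows P up to position cutP and then Q from position cutQ on.
  record Splice : Set where
    field
      P      : Path G x y
      Q      : Path G y z
      cutP   : Fin (suc (len P))
      cutQ   : Fin (suc (len Q))
      P-cut  : vert P cutP ≡ v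
      Q-cut  : vert Q cutQ ≡ v
      avoids : TailAvoids P Q cutQ

  module Spliced (s : Splice) where
    open Splice s

    p q length : ℕ
    p      = toℕ cutP
    q      = toℕ cutQ
    length = p + (len Q ∸ q)

    p≤len : p ≤ len P
    p≤len = toℕ≤pred[n] cutP

    q≤len : q ≤ len Q
    q≤len = toℕ≤pred[n] cutQ

    vertAt-P-p : vertAt P p ≡ v
    vertAt-P-p = trans (vertAt-toℕ P cutP) P-cut

    vertAt-Q-q : vertAt Q q ≡ v
    vertAt-Q-q = trans (vertAt-toℕ Q cutQ) Q-cut

    -- position k ≥ p of the splice is position qIdx k of Q
    qIdx : ℕ → ℕ
    qIdx k = q + (k ∸ p)

    qIdx-p : qIdx p ≡ q
    qIdx-p = trans (cong (q +_) (n∸n≡0 p)) (+-identityʳ q)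

    qIdx-length : qIdx length ≡ len Q
    qIdx-length = trans (cong (q +_) (m+n∸m≡n p _)) (m+[n∸m]≡n q≤len)

    qIdx-suc : ∀ {k} → p ≤ k → qIdx (suc k) ≡ suc (qIdx k)
    qIdx-suc {k} p≤k = trans (cong (q +_) (+-∸-assoc 1 p≤k)) (+-suc q (k ∸ p))

    qIdx-≤ : ∀ {k} → p ≤ k → k ≤ length → qIdx k ≤ len Q
    qIdx-≤ {k} p≤k k≤ =
      subst (qIdx k ≤_) (m+[n∸m]≡n q≤len)
        (+-monoʳ-≤ q (subst (k ∸ p ≤_) (m+n∸m≡n p _) (∸-monoˡ-≤ p k≤)))

    qIdx-< : (k : Fin length) → p ≤ toℕ k → qIdx (toℕ k) < len Q
    qIdx-< k p≤k = subst (_≤ len Q) (qIdx-suc p≤k) (qIdx-≤ (m≤n⇒m≤1+n p≤k) (toℕ<n k))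

    qIdx-strictMono : ∀ {k l} → p ≤ k → k < l → qIdx k < qIdx l
    qIdx-strictMono p≤k k<l = +-monoʳ-< q (∸-monoˡ-< k<l p≤k)

    qIdx-cancel-< : ∀ {k l} → p ≤ k → p ≤ l → qIdx k < qIdx l → k < l
    qIdx-cancel-< p≤k p≤l lt = m∸o<n∸o⇒m<n p≤k p≤l (+-cancelˡ-< q _ _ lt)

    vertℕ : ℕ → V
    vertℕ k with k ≤? p
    ... | yes _ = vertAt P k
    ... | no  _ = vertAt Q (qIdx k)

    vertℕ-P : ∀ {k} → k ≤ p → vertℕ k ≡ vertAt P k
    vertℕ-P {k} k≤p with k ≤? p
    ... | yes _   = refl
    ... | no  k≰p = contradiction k≤p k≰p

    vertℕ-Q : ∀ {k} → p ≤ k → vertℕ k ≡ vertAt Q (qIdx k)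
    vertℕ-Q {k} p≤k with k ≤? p
    ... | no _ = refl
    ... | yes k≤p with ≤-antisym k≤p p≤k
    ...   | refl = begin
      vertAt P p         ≡⟨ vertAt-P-p ⟩
      v                  ≡⟨ vertAt-Q-q ⟨
      vertAt Q q         ≡⟨ cong (vertAt Q) qIdx-p ⟨
      vertAt Q (qIdx p)  ∎
      where open ≡-Reasoning

    vertℕ-P-at : ∀ {k} (f : Fin (suc (len P))) → k ≤ p → toℕ f ≡ k → vertℕ k ≡ vert P f
    vertℕ-P-at f k≤p refl = trans (vertℕ-P k≤p) (vertAt-toℕ P f)

    vertℕ-Q-at : ∀ {k} (g : Fin (suc (len Q))) → p ≤ k → toℕ g ≡ qIdx k → vertℕ k ≡ vert Q g
    vertℕ-Q-at g p≤k g≡ = trans (vertℕ-Q p≤k) (trans (cong (vertAt Q) (sym g≡)) (vertAt-toℕ Q g))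

    data EdgeOrigin (k : Fin length) : Set where
      on-P : (f : Fin (len P)) → toℕ f ≡ toℕ k → toℕ k < p → EdgeOrigin k
      on-Q : (g : Fin (len Q)) → toℕ g ≡ qIdx (toℕ k) → p ≤ toℕ k → EdgeOrigin k

    edgeOrigin : ∀ k → EdgeOrigin k
    edgeOrigin k with suc (toℕ k) ≤? p
    ... | yes k<p = on-P (fromℕ< (≤-trans k<p p≤len)) (toℕ-fromℕ< _) k<p
    ... | no  k≮p = on-Q (fromℕ< (qIdx-< k p≤k)) (toℕ-fromℕ< _) p≤k
      where p≤k = ≤-pred (≰⇒> k≮p)

    originEdge : ∀ {k} → EdgeOrigin k → E
    originEdge (on-P f _ _) = edge P f
    originEdge (on-Q g _ _) = edge Q g

    edgeAt : Fin length → E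
    edgeAt k = originEdge (edgeOrigin k)

    originEdge-links : ∀ {k} (o : EdgeOrigin k) →
      Joins G (originEdge o) (vertℕ (toℕ k)) (vertℕ (suc (toℕ k)))
    originEdge-links (on-P f f≡k k<p) =
      subst₂ (Joins G (edge P f))
        (sym (vertℕ-P-at (inject₁ f) (<⇒≤ k<p) (trans (toℕ-inject₁ f) f≡k)))
        (sym (vertℕ-P-at (suc f) k<p (cong suc f≡k)))
        (links P f)
    originEdge-links (on-Q g g≡ p≤k) =
      subst₂ (Joins G (edge Q g))
        (sym (vertℕ-Q-at (inject₁ g) p≤k (trans (toℕ-inject₁ g) g≡)))
        (sym (vertℕ-Q-at (suc g) (m≤n⇒m≤1+n p≤k) (trans (cong suc g≡) (sym (qIdx-suc p≤k)))))
        (links Q g)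

  module _ (s t : Splice) where
    private
      module S₁ = Spliced s
      module S₂ = Spliced t

    meets-only-at-cut : TailAvoids (Splice.P t) (Splice.Q s) (Splice.cutQ s) →
      ∀ {k l} → S₁.p ≤ k → k ≤ S₁.length → l ≤ S₂.p → S₁.vertℕ k ≡ S₂.vertℕ l →
      k ≡ S₁.p × l ≡ S₂.p
    meets-only-at-cut avoids {k} {l} p≤k k≤ l≤p eq = k≡p , l≡p
      where
      K≤ : S₁.qIdx k ≤ len (Splice.Q s)
      K≤ = S₁.qIdx-≤ p≤k k≤
      meet : vertAt (Splice.Q s) (S₁.qIdx k) ≡ vertAt (Splice.P t) l
      meet = trans (sym (S₁.vertℕ-Q p≤k)) (trans eq (S₂.vertℕ-P l≤p))
      meet-v : vertAt (Splice.Q s) (S₁.qIdx k) ≡ v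
      meet-v = avoids _ (subst (S₁.q ≤_) (sym (toℕ-clamp K≤)) (m≤m+n _ _)) (_ , sym meet)
      K≡q : S₁.qIdx k ≡ S₁.q
      K≡q = vertAt-injective (Splice.Q s) K≤ S₁.q≤len (trans meet-v (sym S₁.vertAt-Q-q))
      k≡p : k ≡ S₁.p
      k≡p = ≤-antisym (m∸n≡0⇒m≤n (+-cancelˡ-≡ S₁.q _ _ (trans K≡q (sym (+-identityʳ _))))) p≤k
      l≡p : l ≡ S₂.p
      l≡p = vertAt-injective (Splice.P t) (≤-trans l≤p S₂.p≤len) S₂.p≤len
              (trans (sym meet) (trans meet-v (sym S₂.vertAt-P-p)))

  module _ (s : Splice) where
    open Splice s
    open Spliced s

    vertℕ-injective : ∀ {k l} → k ≤ length → l ≤ length → vertℕ k ≡ vertℕ l → k ≡ l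
    vertℕ-injective {k} {l} k≤ l≤ eq with ≤-<-connex k p | ≤-<-connex l p
    ... | inj₁ k≤p | inj₁ l≤p =
      vertAt-injective P (≤-trans k≤p p≤len) (≤-trans l≤p p≤len)
        (trans (sym (vertℕ-P k≤p)) (trans eq (vertℕ-P l≤p)))
    ... | inj₂ p<k | inj₂ p<l =
      ∸-cancelʳ-≡ (<⇒≤ p<k) (<⇒≤ p<l) (+-cancelˡ-≡ q _ _
        (vertAt-injective Q (qIdx-≤ (<⇒≤ p<k) k≤) (qIdx-≤ (<⇒≤ p<l) l≤)
          (trans (sym (vertℕ-Q (<⇒≤ p<k))) (trans eq (vertℕ-Q (<⇒≤ p<l))))))
    ... | inj₁ k≤p | inj₂ p<l =
      let l≡p , k≡p = meets-only-at-cut s s avoids (<⇒≤ p<l) l≤ k≤p (sym eq)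
      in  trans k≡p (sym l≡p)
    ... | inj₂ p<k | inj₁ l≤p =
      let k≡p , l≡p = meets-only-at-cut s s avoids (<⇒≤ p<k) k≤ l≤p eq
      in  trans k≡p (sym l≡p)

    splice : Path G x z
    splice = record
      { len      = length
      ; vert     = vertℕ ∘ toℕ
      ; edge     = edgeAt
      ; start    = trans (vertℕ-P z≤n) (start P)
      ; finish   = trans (cong vertℕ (toℕ-fromℕ length))
                     (trans (vertℕ-Q-at (fromℕ (len Q)) (m≤m+n p _)
                               (trans (toℕ-fromℕ (len Q)) (sym qIdx-length)))
                            (finish Q))
      ; distinct = λ eq → toℕ-injective (vertℕ-injective (toℕ≤pred[n] _) (toℕ≤pred[n] _) eq)
      ; links    = λ k →
          subst (λ i → Joins G (edgeAt k) (vertℕ i) (vertℕ (suc (toℕ k))))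
            (sym (toℕ-inject₁ k)) (originEdge-links (edgeOrigin k))
      }

  module _ (s t : Splice)
           (s-avoids-t : TailAvoids (Splice.P s) (Splice.Q t) (Splice.cutQ t))
           (t-avoids-s : TailAvoids (Splice.P t) (Splice.Q s) (Splice.cutQ s)) where
    private
      module S₁ = Spliced s
      module S₂ = Spliced t

    stays-in-P : ∀ {k l} → k ≤ S₁.p → l ≤ S₂.length → S₁.vertℕ k ≡ S₂.vertℕ l → l ≤ S₂.p
    stays-in-P {k} {l} k≤p l≤ eq with ≤-<-connex l S₂.p
    ... | inj₁ l≤p = l≤p
    ... | inj₂ p<l =
      ≤-reflexive (proj₁ (meets-only-at-cut t s s-avoids-t (<⇒≤ p<l) l≤ k≤p (sym eq)))

    stays-in-Q : ∀ {k l} → k ≤ S₁.length → S₁.p < k → S₁.vertℕ k ≡ S₂.vertℕ l → S₂.p < l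
    stays-in-Q {k} {l} k≤ p<k eq with ≤-<-connex l S₂.p
    ... | inj₂ p<l = p<l
    ... | inj₁ l≤p =
      contradiction (proj₁ (meets-only-at-cut s t t-avoids-s (<⇒≤ p<k) k≤ l≤p eq)) (>⇒≢ p<k)

    vertℕ-orderCompatible :
      OrderCompatible G (Splice.P s) (Splice.P t) → OrderCompatible G (Splice.Q s) (Splice.Q t) →
      ∀ {i j k l} → i ≤ S₁.length → j ≤ S₁.length → k ≤ S₂.length → l ≤ S₂.length →
      S₁.vertℕ i ≡ S₂.vertℕ k → S₁.vertℕ j ≡ S₂.vertℕ l → i < j → k < l
    vertℕ-orderCompatible ocP ocQ {i} {j} i≤ j≤ k≤ l≤ eik ejl i<j
      with ≤-<-connex i S₁.p | ≤-<-connex j S₁.p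
    ... | inj₁ i≤p | inj₁ j≤p =
      vertAt-orderCompatible (Splice.P s) (Splice.P t) ocP
        (≤-trans i≤p S₁.p≤len) (≤-trans j≤p S₁.p≤len) (≤-trans k≤p S₂.p≤len) (≤-trans l≤p S₂.p≤len)
        (trans (sym (S₁.vertℕ-P i≤p)) (trans eik (S₂.vertℕ-P k≤p)))
        (trans (sym (S₁.vertℕ-P j≤p)) (trans ejl (S₂.vertℕ-P l≤p)))
        i<j
      where
      k≤p = stays-in-P i≤p k≤ eik
      l≤p = stays-in-P j≤p l≤ ejl
    ... | inj₁ i≤p | inj₂ p<j = ≤-<-trans (stays-in-P i≤p k≤ eik) (stays-in-Q j≤ p<j ejl)
    ... | inj₂ p<i | inj₁ j≤p = contradiction (<-trans p<i i<j) (≤⇒≯ j≤p)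
    ... | inj₂ p<i | inj₂ p<j =
      S₂.qIdx-cancel-< p≤k p≤l
        (vertAt-orderCompatible (Splice.Q s) (Splice.Q t) ocQ
          (S₁.qIdx-≤ (<⇒≤ p<i) i≤) (S₁.qIdx-≤ (<⇒≤ p<j) j≤) (S₂.qIdx-≤ p≤k k≤) (S₂.qIdx-≤ p≤l l≤)
          (trans (sym (S₁.vertℕ-Q (<⇒≤ p<i))) (trans eik (S₂.vertℕ-Q p≤k)))
          (trans (sym (S₁.vertℕ-Q (<⇒≤ p<j))) (trans ejl (S₂.vertℕ-Q p≤l)))
          (S₁.qIdx-strictMono (<⇒≤ p<i) i<j))
      where
      p≤k = <⇒≤ (stays-in-Q i≤ p<i eik)
      p≤l = <⇒≤ (stays-in-Q j≤ p<j ejl)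

    splice-orderCompatible :
      OrderCompatible G (Splice.P s) (Splice.P t) → OrderCompatible G (Splice.Q s) (Splice.Q t) →
      OrderCompatible G (splice s) (splice t)
    splice-orderCompatible ocP ocQ i j k l =
      vertℕ-orderCompatible ocP ocQ
        (toℕ≤pred[n] i) (toℕ≤pred[n] j) (toℕ≤pred[n] k) (toℕ≤pred[n] l)

    originEdge-≢ :
      EdgeDisjoint G (Splice.P s) (Splice.P t) → EdgeDisjoint G (Splice.Q s) (Splice.Q t) →
      ∀ {k l} (o : S₁.EdgeOrigin k) (o′ : S₂.EdgeOrigin l) → S₁.originEdge o ≢ S₂.originEdge o′
    originEdge-≢ edP edQ (S₁.on-P f _ _) (S₂.on-P f′ _ _) = edP f f′
    originEdge-≢ edP edQ (S₁.on-Q g _ _) (S₂.on-Q g′ _ _) = edQ g g′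
    originEdge-≢ edP edQ (S₁.on-P f _ _) (S₂.on-Q g′ g′≡ _) =
      tail-edge-≢ (Splice.P s) (Splice.Q t) s-avoids-t g′
        (subst (S₂.q ≤_) (sym g′≡) (m≤m+n _ _)) f
    originEdge-≢ edP edQ (S₁.on-Q g g≡ _) (S₂.on-P f′ _ _) =
      tail-edge-≢ (Splice.P t) (Splice.Q s) t-avoids-s g
        (subst (S₁.q ≤_) (sym g≡) (m≤m+n _ _)) f′ ∘ sym

    splice-edgeDisjoint :
      EdgeDisjoint G (Splice.P s) (Splice.P t) → EdgeDisjoint G (Splice.Q s) (Splice.Q t) →
      EdgeDisjoint G (splice s) (splice t)
    splice-edgeDisjoint edP edQ k l = originEdge-≢ edP edQ (S₁.edgeOrigin k) (S₂.edgeOrigin l)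

IsTerminal⇒TailAvoids : ∀ {G : Graph} {a b c} (𝒫ab : GoodFamily G a b) (𝒫bc : GoodFamily G b c)
  {S T : ℕ → Set} {v} → IsTerminal G 𝒫ab S 𝒫bc T v →
  ∀ s t → S s → T t → ∀ j → vert (path 𝒫bc t) j ≡ v →
  Splicing.TailAvoids v (path 𝒫ab s) (path 𝒫bc t) j
IsTerminal⇒TailAvoids _ _ (_ , _ , terminal) _ _ s∈S t∈T _ Qj≡v l j≤l (i , eq) =
  terminal _ t∈T _ l Qj≡v j≤l (_ , s∈S , i , eq)

lemma3p2 : (G : Graph) → (a b c : Graph.V G) →
    a ≢ b → b ≢ c → a ≢ c →
    (𝒫ab : GoodFamily G a b) → (𝒫bc : GoodFamily G b c) →
    (S T : ℕ → Set) → Infinite S → Infinite T →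
    (v : Graph.V G) → IsTerminal G 𝒫ab S 𝒫bc T v →
    Infinite (λ i → S i × OnPath G v (path 𝒫ab i)) →
    GoodFamily G a c
lemma3p2 G _ _ _ _ _ _ 𝒫ab 𝒫bc S T _ infT v terminal infSv = record
  { path      = splice ∘ spliceAt
  ; edgeDisj  = λ m n m≢n →
      splice-edgeDisjoint (spliceAt m) (spliceAt n) (avoids m n) (avoids n m)
        (edgeDisj 𝒫ab _ _ (m≢n ∘ σ.select-injective))
        (edgeDisj 𝒫bc _ _ (m≢n ∘ τ.select-injective))
  ; orderComp = λ m n →
      splice-orderCompatible (spliceAt m) (spliceAt n) (avoids m n) (avoids n m)
        (orderComp 𝒫ab _ _) (orderComp 𝒫bc _ _)
  }
  where
  open Splicing v
  module σ = Enumeration infSv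
  module τ = Enumeration infT

  v-on-Q : ∀ n → OnPath G v (path 𝒫bc (τ.select n))
  v-on-Q n = proj₁ (proj₂ terminal) _ (τ.select-∈ n)

  avoids : ∀ m n → TailAvoids (path 𝒫ab (σ.select m)) (path 𝒫bc (τ.select n)) (proj₁ (v-on-Q n))
  avoids m n = IsTerminal⇒TailAvoids 𝒫ab 𝒫bc terminal (σ.select m) (τ.select n)
    (proj₁ (σ.select-∈ m)) (τ.select-∈ n) _ (proj₂ (v-on-Q n))

  spliceAt : ℕ → Splice
  spliceAt n = record
    { P      = path 𝒫ab (σ.select n)
    ; Q      = path 𝒫bc (τ.select n)
    ; cutP   = proj₁ (proj₂ (σ.select-∈ n))
    ; cutQ   = proj₁ (v-on-Q n)
    ; P-cut  = proj₂ (proj₂ (σ.select-∈ n))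
    ; Q-cut  = proj₂ (v-on-Q n)
    ; avoids = avoids n n
    }
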